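{- Let $T$ be a rooted tree and let $\mathcal{Q}$ be a collection of connected subgraphs of $T$ whose vertex sets partition $V(T)$. Let $X,Y\subseteq V(T)$ with $X\subseteq Y$ and $\mathrm{LCA}(T,X)=X$. If $\mathcal{Q}(X)=\mathcal{Q}(Y)$, then $\mathcal{Q}(Y)=\mathcal{Q}(\mathrm{LCA}(T,Y))$.
   Context: For vertices $u,v$ (not necessarily distinct) of a rooted tree $T$, $\mathrm{lca}(T,u,v)$ is the vertex furthest from the root having both $u$ and $v$ as descendants (every vertex is a descendant of itself). For $Y\subseteq V(T)$, $\mathrm{LCA}(T,Y)=\{\mathrm{lca}(T,u,v)\mid u,v\in Y\}$. For $X\subseteq V(T)$, $\mathcal{Q}(X)=\{Q\in\mathcal{Q}\mid V(Q)\cap X\neq\emptyset\}$. -}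

module Defs where

open import Data.Nat using (ℕ; zero; suc; _≤_; _<_)
open import Data.Fin using (Fin)
open import Data.Product using (Σ; ∃; ∃-syntax; _×_; _,_)
open import Data.Sum using (_⊎_)
open import Relation.Nullary using (¬_)
open import Relation.Binary.PropositionalEquality using (_≡_; _≢_)
open import Relation.Binary.Construct.Closure.ReflexiveTransitive using (Star)
open import Function.Bundles using (_⇔_)

iter : ∀ {A : Set} → (A → A) → ℕ → A → A
iter f zero    x = x
iter f (suc k) x = f (iter f k x)

-- Edges are {v , parent v} for v ≠ root.  This describes exactly
-- the rooted trees on vertex set Fin n.
record RootedTree (n : ℕ) : Set where
  field
    root        : Fin n
    parent      : Fin n → Fin n
    parent-root : parent root ≡ root
    reach-root  : ∀ v → ∃[ k ] iter parent k v ≡ root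

module _ {n : ℕ} (T : RootedTree n) where
  open RootedTree T

  Adj : Fin n → Fin n → Set
  Adj u v = (parent u ≡ v × u ≢ v) ⊎ (parent v ≡ u × u ≢ v)

  Descendant : Fin n → Fin n → Set
  Descendant u v = ∃[ k ] iter parent k u ≡ v

  Depth : Fin n → ℕ → Set
  Depth v k = iter parent k v ≡ root × (∀ j → j < k → iter parent j v ≢ root)

  CommonAnc : Fin n → Fin n → Fin n → Set
  CommonAnc u v w = Descendant u w × Descendant v w

  IsLCA : Fin n → Fin n → Fin n → Set
  IsLCA u v w = CommonAnc u v w ×
    (∀ w' → CommonAnc u v w' → ∀ d d' → Depth w d → Depth w' d' → d' ≤ d)

  LCA : (Fin n → Set) → (Fin n → Set)
  LCA Y w = ∃[ u ] ∃[ v ] (Y u × Y v × IsLCA u v w)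

  record Subgraph : Set₁ where
    field
      V  : Fin n → Set
      E  : Fin n → Fin n → Set
      E-edge : ∀ {u v} → E u v → Adj u v × V u × V v

  Connected : Subgraph → Set
  Connected Q = ∀ u v → V u → V v → Star (λ a b → E a b ⊎ E b a) u v
    where open Subgraph Q

Partitions : ∀ {n m} (T : RootedTree n) → (Fin m → Subgraph T) → Set
Partitions {n} {m} T Q =
  (∀ v → ∃[ i ] (Subgraph.V (Q i) v × (∀ j → Subgraph.V (Q j) v → j ≡ i)))
  × (∀ i → ∃[ v ] Subgraph.V (Q i) v)

-- 𝒬(X) as a set of indices: those i with V(Q i) ∩ X ≠ ∅.
Meets : ∀ {n m} {T : RootedTree n} → (Fin m → Subgraph T) → (Fin n → Set) → Fin m → Set
Meets Q X i = ∃[ x ] (X x × Subgraph.V (Q i) x)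

_≐_ : ∀ {A : Set} → (A → Set) → (A → Set) → Set
P ≐ R = ∀ a → P a ⇔ R a

{-# OPTIONS --safe #-}
-- Every vertex of Y is lca(y, y), so 𝒬(Y) ⊆ 𝒬(LCA(T,Y)).  Conversely, let
-- w = lca(u, v) with u, v ∈ Y lie in a part Q.  If u or v is w, or lies in Q,
-- we are done.  Otherwise u and v lie below distinct children c₁, c₂ of w, in
-- parts Qᵤ, Qᵥ avoiding w.  A connected subgraph that avoids w and meets the
-- subtree of c₁ stays inside it, so the vertices x, x′ of X which Qᵤ, Qᵥ
-- contain (as 𝒬(X) = 𝒬(Y)) lie below c₁ and c₂ respectively.  Hence
-- w = lca(x, x′) ∈ LCA(T,X) = X ⊆ Y.
module Submission where

open import Defs
open import Data.Nat using (ℕ; zero; suc; _+_; _*_; _∸_; _≤_; _<_; s≤s)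
open import Data.Nat.Properties using (+-comm; m∸n+n≡m; m≤m*n; ≤-total; 1+n≰n; ≰⇒>; _≤?_; anyUpTo?)
open import Data.Nat.Induction using (<-wellFounded)
open import Induction.WellFounded using (Acc; acc)
open import Data.Fin using (Fin; _≟_)
open import Data.Product using (∃; ∃-syntax; ∃₂; _×_; _,_; proj₁)
open import Data.Sum as Sum using (_⊎_; inj₁; inj₂)
open import Data.Empty using (⊥-elim)
open import Relation.Nullary using (¬_; yes; no)
open import Relation.Unary using (Decidable)
open import Relation.Binary.PropositionalEquality
open import Relation.Binary.Construct.Closure.ReflexiveTransitive using (Star; ε; _◅_)
open import Function.Bundles using (mk⇔; module Equivalence)
open Equivalence using (to; from)

module _ {A : Set} (f : A → A) where
  open ≡-Reasoning

  iter-+ : ∀ m n x → iter f (m + n) x ≡ iter f m (iter f n x)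
  iter-+ zero    n x = refl
  iter-+ (suc m) n x = cong f (iter-+ m n x)

  iter-∸ : ∀ {m n} x → n ≤ m → iter f m x ≡ iter f (m ∸ n) (iter f n x)
  iter-∸ {m} {n} x n≤m = begin
    iter f m x             ≡⟨ cong (λ k → iter f k x) (sym (m∸n+n≡m n≤m)) ⟩
    iter f (m ∸ n + n) x   ≡⟨ iter-+ (m ∸ n) n x ⟩
    iter f (m ∸ n) (iter f n x) ∎

  iter-iter-comm : ∀ m n x → iter f m (iter f n x) ≡ iter f n (iter f m x)
  iter-iter-comm m n x = begin
    iter f m (iter f n x) ≡⟨ sym (iter-+ m n x) ⟩
    iter f (m + n) x      ≡⟨ cong (λ k → iter f k x) (+-comm m n) ⟩
    iter f (n + m) x      ≡⟨ iter-+ n m x ⟩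
    iter f n (iter f m x) ∎

  iter-commute : ∀ k x → iter f k (f x) ≡ f (iter f k x)
  iter-commute k x = iter-iter-comm k 1 x

  iter-periodic : ∀ {p x} → iter f p x ≡ x → ∀ t → iter f (t * p) x ≡ x
  iter-periodic e zero    = refl
  iter-periodic {p} {x} e (suc t) = begin
    iter f (p + t * p) x        ≡⟨ iter-+ p (t * p) x ⟩
    iter f p (iter f (t * p) x) ≡⟨ cong (iter f p) (iter-periodic e t) ⟩
    iter f p x                  ≡⟨ e ⟩
    x                           ∎

least-witness : ∀ {P : ℕ → Set} → Decidable P → ∀ {k} → P k →
                ∃[ j ] (P j × (∀ i → i < j → ¬ P i))
least-witness {P} P? = search (<-wellFounded _)
  where
  search : ∀ {k} → Acc _<_ k → P k → ∃[ j ] (P j × (∀ i → i < j → ¬ P i))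
  search {k} (acc smaller) Pk with anyUpTo? P? k
  ... | yes (j , j<k , Pj) = search (smaller j<k) Pj
  ... | no none            = k , Pk , λ i i<k Pi → none (i , i<k , Pi)

module _ {n : ℕ} (T : RootedTree n) where
  open RootedTree T
  open ≡-Reasoning

  Child : Fin n → Fin n → Set
  Child c w = parent c ≡ w × c ≢ w

  Descendant-trans : ∀ {a b c} → Descendant T a b → Descendant T b c → Descendant T a c
  Descendant-trans {a} (k , refl) (l , refl) = l + k , iter-+ parent l k a

  Descendant-step : ∀ {a b} → Descendant T a b → a ≡ b ⊎ Descendant T (parent a) b
  Descendant-step     (zero  , e) = inj₁ e
  Descendant-step {a} (suc k , e) = inj₂ (k , trans (iter-commute parent k a) e)

  ancestors-comparable : ∀ {x a b} → Descendant T x a → Descendant T x b →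
                         Descendant T a b ⊎ Descendant T b a
  ancestors-comparable {x} (j , refl) (l , refl) with ≤-total l j
  ... | inj₁ l≤j = inj₂ (j ∸ l , sym (iter-∸ parent x l≤j))
  ... | inj₂ j≤l = inj₁ (l ∸ j , sym (iter-∸ parent x j≤l))

  iter-root : ∀ k → iter parent k root ≡ root
  iter-root zero    = refl
  iter-root (suc k) = trans (cong parent (iter-root k)) parent-root

  periodic⇒root : ∀ {a q} → iter parent (suc q) a ≡ a → a ≡ root
  periodic⇒root {a} {q} e with reach-root a
  ... | r , a↝root = begin
    a                                             ≡⟨ sym (iter-periodic parent e r) ⟩
    iter parent (r * suc q) a                     ≡⟨ iter-∸ parent a (m≤m*n r (suc q)) ⟩
    iter parent (r * suc q ∸ r) (iter parent r a) ≡⟨ cong (iter parent (r * suc q ∸ r)) a↝root ⟩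
    iter parent (r * suc q ∸ r) root              ≡⟨ iter-root (r * suc q ∸ r) ⟩
    root                                          ∎

  child-≢-root : ∀ {c w} → Child c w → c ≢ root
  child-≢-root (pc , c≢w) refl = c≢w (trans (sym parent-root) pc)

  child-not-ancestor : ∀ {c w} → Child c w → ¬ Descendant T w c
  child-not-ancestor {c} ch@(pc , _) (r , w↝c) =
    child-≢-root ch (periodic⇒root {q = r} (trans (sym (iter-commute parent r c))
                                                  (trans (cong (iter parent r) pc) w↝c)))

  sibling-not-descendant : ∀ {c₁ c₂ w} → Child c₁ w → Child c₂ w → c₁ ≢ c₂ →
                           ¬ Descendant T c₁ c₂
  sibling-not-descendant (pc₁ , _) ch₂ c₁≢c₂ c₁↝c₂ with Descendant-step c₁↝c₂
  ... | inj₁ c₁≡c₂ = c₁≢c₂ c₁≡c₂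
  ... | inj₂ pc₁↝c₂ = child-not-ancestor ch₂ (subst (λ p → Descendant T p _) pc₁ pc₁↝c₂)

  sibling-subtrees-disjoint : ∀ {c₁ c₂ w z} → Child c₁ w → Child c₂ w → c₁ ≢ c₂ →
                              Descendant T z c₁ → ¬ Descendant T z c₂
  sibling-subtrees-disjoint ch₁ ch₂ c₁≢c₂ z↝c₁ z↝c₂ with ancestors-comparable z↝c₁ z↝c₂
  ... | inj₁ c₁↝c₂ = sibling-not-descendant ch₁ ch₂ c₁≢c₂ c₁↝c₂
  ... | inj₂ c₂↝c₁ = sibling-not-descendant ch₂ ch₁ (≢-sym c₁≢c₂) c₂↝c₁

  ancestor-above-or-below : ∀ {x c w a} → Descendant T x c → parent c ≡ w → Descendant T x a →
                            Descendant T w a ⊎ Descendant T a c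
  ancestor-above-or-below x↝c pc x↝a with ancestors-comparable x↝c x↝a
  ... | inj₂ a↝c = inj₂ a↝c
  ... | inj₁ c↝a with Descendant-step c↝a
  ...   | inj₁ refl = inj₂ (0 , refl)
  ...   | inj₂ pc↝a = inj₁ (subst (λ p → Descendant T p _) pc pc↝a)

  ≡-or-below-child : ∀ {u w} k → iter parent k u ≡ w → u ≡ w ⊎ ∃[ c ] (Child c w × Descendant T u c)
  ≡-or-below-child zero e = inj₁ e
  ≡-or-below-child {u} {w} (suc k) e with iter parent k u ≟ w
  ... | yes e′ = ≡-or-below-child k e′
  ... | no  ne = inj₂ (iter parent k u , (e , ne) , k , refl)

  depth : ∀ v → ∃ (Depth T v)
  depth v = let k , v↝root = reach-root v
            in least-witness (λ j → iter parent j v ≟ root) {k} v↝root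

  Depth-minimal : ∀ {v d e} → Depth T v d → iter parent e v ≡ root → d ≤ e
  Depth-minimal {d = d} {e} (_ , below-root) v↝root with d ≤? e
  ... | yes d≤e = d≤e
  ... | no  d≰e = ⊥-elim (below-root e (≰⇒> d≰e) v↝root)

  Depth-antitone : ∀ {u v d d′} → Descendant T u v → Depth T u d → Depth T v d′ → d′ ≤ d
  Depth-antitone {u} {d = d} (k , refl) (u↝root , _) dv = Depth-minimal dv (begin
    iter parent d (iter parent k u) ≡⟨ iter-iter-comm parent d k u ⟩
    iter parent k (iter parent d u) ≡⟨ cong (iter parent k) u↝root ⟩
    iter parent k root              ≡⟨ iter-root k ⟩
    root                            ∎)

  Depth-child : ∀ {c w d} → Depth T w d → Child c w → Depth T c (suc d)
  Depth-child {c} {w} {d} (w↝root , below-root) ch@(pc , _) = step-up d w↝root , c-below-root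
    where
    step-up : ∀ k {v} → iter parent k w ≡ v → iter parent (suc k) c ≡ v
    step-up k e = trans (sym (iter-commute parent k c)) (trans (cong (iter parent k) pc) e)

    c-below-root : ∀ j → j < suc d → iter parent j c ≢ root
    c-below-root zero    _         = child-≢-root ch
    c-below-root (suc j) (s≤s j<d) c↝root =
      below-root j j<d (trans (sym (step-up j refl)) c↝root)

  IsLCA-self : ∀ y → IsLCA T y y y
  IsLCA-self y = ((0 , refl) , (0 , refl)) , λ w′ (y↝w′ , _) d d′ dy dw′ → Depth-antitone y↝w′ dy dw′

  IsLCA-children : ∀ {c₁ c₂ w x x′} → Child c₁ w → Child c₂ w → c₁ ≢ c₂ →
                   Descendant T x c₁ → Descendant T x′ c₂ → IsLCA T x x′ w
  IsLCA-children {w = w} {x} {x′} ch₁@(pc₁ , _) ch₂@(pc₂ , _) c₁≢c₂ x↝c₁ x′↝c₂ =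
    (Descendant-trans x↝c₁ (1 , pc₁) , Descendant-trans x′↝c₂ (1 , pc₂)) ,
    λ a (x↝a , x′↝a) d d′ dw da → Depth-antitone (above-w x↝a x′↝a) dw da
    where
    above-w : ∀ {a} → Descendant T x a → Descendant T x′ a → Descendant T w a
    above-w x↝a x′↝a
      with ancestor-above-or-below x↝c₁ pc₁ x↝a | ancestor-above-or-below x′↝c₂ pc₂ x′↝a
    ... | inj₁ w↝a  | _         = w↝a
    ... | inj₂ _    | inj₁ w↝a  = w↝a
    ... | inj₂ a↝c₁ | inj₂ a↝c₂ = ⊥-elim (sibling-subtrees-disjoint ch₁ ch₂ c₁≢c₂ a↝c₁ a↝c₂)

  IsLCA-cases : ∀ {u v w} → IsLCA T u v w →
                u ≡ w ⊎ v ≡ w ⊎ ∃₂ λ c₁ c₂ → Child c₁ w × Child c₂ w × c₁ ≢ c₂ ×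
                                               Descendant T u c₁ × Descendant T v c₂
  IsLCA-cases {w = w} (((k , u↝w) , (l , v↝w)) , deepest)
    with ≡-or-below-child k u↝w | ≡-or-below-child l v↝w
  ... | inj₁ u≡w | _        = inj₁ u≡w
  ... | inj₂ _   | inj₁ v≡w = inj₂ (inj₁ v≡w)
  ... | inj₂ (c₁ , ch₁ , u↝c₁) | inj₂ (c₂ , ch₂ , v↝c₂) =
    inj₂ (inj₂ (c₁ , c₂ , ch₁ , ch₂ , c₁≢c₂ , u↝c₁ , v↝c₂))
    where
    c₁≢c₂ : c₁ ≢ c₂
    c₁≢c₂ refl = let d , dw = depth w
                 in 1+n≰n (deepest c₁ (u↝c₁ , v↝c₂) d (suc d) dw (Depth-child dw ch₁))

  module _ (S : Subgraph T) where
    open Subgraph S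

    walk-step : ∀ {a b} → E a b ⊎ E b a → (parent a ≡ b ⊎ parent b ≡ a) × V b
    walk-step (inj₁ e) = let adj , _ , b∈S = E-edge e in Sum.map proj₁ proj₁ adj , b∈S
    walk-step (inj₂ e) = let adj , b∈S , _ = E-edge e in Sum.swap (Sum.map proj₁ proj₁ adj) , b∈S

    step-stays-below : ∀ {a b c w} → parent c ≡ w → parent a ≡ b ⊎ parent b ≡ a → b ≢ w →
                       Descendant T a c → Descendant T b c
    step-stays-below pc (inj₁ refl) b≢w a↝c with Descendant-step a↝c
    ... | inj₁ refl = ⊥-elim (b≢w pc)
    ... | inj₂ pa↝c = pa↝c
    step-stays-below pc (inj₂ pb≡a) _ a↝c = Descendant-trans (1 , pb≡a) a↝c

    walk-stays-below : ∀ {a b c w} → ¬ V w → parent c ≡ w →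
                       Star (λ x y → E x y ⊎ E y x) a b → Descendant T a c → Descendant T b c
    walk-stays-below w∉S pc ε a↝c = a↝c
    walk-stays-below w∉S pc (st ◅ walk) a↝c =
      let adj , b∈S = walk-step st
      in walk-stays-below w∉S pc walk (step-stays-below pc adj (λ { refl → w∉S b∈S }) a↝c)

    connected-stays-below : ∀ {u x c w} → Connected T S → ¬ V w → parent c ≡ w →
                            V u → Descendant T u c → V x → Descendant T x c
    connected-stays-below conn w∉S pc u∈S u↝c x∈S =
      walk-stays-below w∉S pc (conn _ _ u∈S x∈S) u↝c

in-part-or-avoiding : ∀ {n m} {T : RootedTree n} (Q : Fin m → Subgraph T) → Partitions T Q →
                      ∀ {i u w} → Subgraph.V (Q i) w →
                      Subgraph.V (Q i) u ⊎ ∃[ a ] (Subgraph.V (Q a) u × ¬ Subgraph.V (Q a) w)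
in-part-or-avoiding Q (part-of , _) {i} {u} {w} w∈i with part-of u | part-of w
... | a , u∈a , _ | _ , _ , unique with a ≟ i
...   | yes refl = inj₁ u∈a
...   | no  a≢i  = inj₂ (a , u∈a , λ w∈a → a≢i (trans (unique a w∈a) (sym (unique i w∈i))))

lemma9 : ∀ {n m} (T : RootedTree n) (Q : Fin m → Subgraph T) →
           (∀ i → Connected T (Q i)) → Partitions T Q →
           (X Y : Fin n → Set) → (∀ v → X v → Y v) → LCA T X ≐ X →
           Meets Q X ≐ Meets Q Y → Meets Q Y ≐ Meets Q (LCA T Y)
lemma9 T Q conn part X Y X⊆Y LCA[X]≐X QX≐QY i = mk⇔ QY⊆QLCA QLCA⊆QY
  where
  open RootedTree T using (parent)
  open Subgraph

  X-below-child : ∀ {a u c w} → Y u → V (Q a) u → ¬ V (Q a) w → parent c ≡ w →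
                  Descendant T u c → ∃[ x ] (X x × Descendant T x c)
  X-below-child {a} u∈Y u∈a w∉a pc u↝c =
    let x , x∈X , x∈a = from (QX≐QY a) (_ , u∈Y , u∈a)
    in x , x∈X , connected-stays-below T (Q a) (conn a) w∉a pc u∈a u↝c x∈a

  QY⊆QLCA : Meets Q Y i → Meets Q (LCA T Y) i
  QY⊆QLCA (y , y∈Y , y∈i) = y , (y , y , y∈Y , y∈Y , IsLCA-self T y) , y∈i

  QLCA⊆QY : Meets Q (LCA T Y) i → Meets Q Y i
  QLCA⊆QY (w , (u , v , u∈Y , v∈Y , lca-uvw) , w∈i) with IsLCA-cases T lca-uvw
  ... | inj₁ refl        = u , u∈Y , w∈i
  ... | inj₂ (inj₁ refl) = v , v∈Y , w∈i
  ... | inj₂ (inj₂ (c₁ , c₂ , ch₁ , ch₂ , c₁≢c₂ , u↝c₁ , v↝c₂))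
    with in-part-or-avoiding Q part {u = u} w∈i | in-part-or-avoiding Q part {u = v} w∈i
  ... | inj₁ u∈i | _        = u , u∈Y , u∈i
  ... | inj₂ _   | inj₁ v∈i = v , v∈Y , v∈i
  ... | inj₂ (a , u∈a , w∉a) | inj₂ (b , v∈b , w∉b) =
    let x  , x∈X  , x↝c₁  = X-below-child u∈Y u∈a w∉a (proj₁ ch₁) u↝c₁
        x′ , x′∈X , x′↝c₂ = X-below-child v∈Y v∈b w∉b (proj₁ ch₂) v↝c₂
        w∈X = to (LCA[X]≐X w) (x , x′ , x∈X , x′∈X , IsLCA-children T ch₁ ch₂ c₁≢c₂ x↝c₁ x′↝c₂)
    in w , X⊆Y w w∈X , w∈i
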